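{- Let $R$ be an $n$-ary cyclic relation on $\mathbb{Q}^k$ that is preserved by $\langle pp\rangle$, and assume that $R$ contains a min-clean tuple $u^1=(u^1_1,\dots,u^1_n)$. Then there exist $I\subseteq[k]$, $q\in\mathbb{Q}$, and $u^2,\dots,u^n\in R$ such that for all $u=(u_1,\dots,u_n)\in R$ the tuple $u'=(u'_1,\dots,u'_n):=pp_q^{(n+1)}(u^1,u^2,\dots,u^n,u)$ satisfies: (i) $I_1(u'_i)=I$ for all $i\le n$; (ii) $u'_i\sim_{[k]\setminus I}u_i$ for all $i\le n$.
   Context: $[k]=\{1,\dots,k\}$. An $n$-ary relation on $\mathbb{Q}^k$ is a nonempty set $R$ of $n$-tuples $t=(t_1,\dots,t_n)$ with $t_i\in\mathbb{Q}^k$ (identified with elements of $\mathbb{Q}^{nk}$); $R$ is cyclic if it is invariant under cyclic shifts of the $n$ coordinates. For $a\in\mathbb{Q}^k$: $\min(a)$ is its minimal entry, $\mathrm{minx}(a)=\{i:a_i=\min(a)\}$, and $I_1(a)=\mathrm{minx}(a)$ (more generally $I_m(a)$ is the set of indices carrying one of the $m$ smallest values of $a$). For $a,b\in\mathbb{Q}^\ell$, $a\sim_\ell b$ iff $a_i\le a_j\Leftrightarrow b_i\le b_j$ for all $i,j$; $a\sim_J b$ means the subtuples on coordinates $J$ satisfy $\sim_{|J|}$. For $t\in R$, $\min(t)$ is the least entry of $t$, $M(t)=\{i\in[n]:\min(t_i)=\min(t)\}$, and $t$ is min-clean if $\mathrm{minx}(t_i)=\mathrm{minx}(t_j)$ for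 all $i,j\in M(t)$. Operations act componentwise. For $q\in\mathbb{Q}$, $pp_q$ is a binary operation on $\mathbb{Q}$ with $pp_q(x,y)\le pp_q(x',y')$ iff ($x\le q$ and $x\le x'$) or ($x,x'>q$ and $y\le y'$); $pp=pp_0$. $\langle pp\rangle$ is the smallest set of operations on $\mathbb{Q}$ containing $pp$, all automorphisms of $(\mathbb{Q};<)$ and projections, closed under composition and interpolation (local closure); preserved by $\langle pp\rangle$ means preserved by all its members. For binary $f$, $f^{(m)}(x_1,\dots,x_m)=f(x_1,f(x_2,\dots,f(x_{m-1},x_m)\dots))$. -}

module Defs where

open import Data.Nat using (ℕ; zero; suc)
open import Data.Nat.DivMod using (_%_; m%n<n)
open import Data.Fin using (Fin; zero; suc; toℕ; fromℕ<)
open import Data.Fin.Subset using (Subset; _∈_; _∉_)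
open import Data.Rational using (ℚ; _≤_; _<_; 0ℚ)
open import Data.Product using (Σ; ∃; _×_; _,_)
open import Data.Sum using (_⊎_)
open import Data.List using (List)
open import Data.List.Relation.Unary.All using (All)
open import Relation.Binary.PropositionalEquality using (_≡_)

infix 2 _↔_
_↔_ : Set → Set → Set
A ↔ B = (A → B) × (B → A)

Vecℚ : ℕ → Set
Vecℚ k = Fin k → ℚ

Tuple : ℕ → ℕ → Set
Tuple n k = Fin n → Vecℚ k

Rel : ℕ → ℕ → Set₁
Rel n k = Tuple n k → Set

Nonempty : ∀ {n k} → Rel n k → Set
Nonempty R = ∃ λ t → R t

rot : ∀ {n} → Fin n → Fin n
rot {suc m} i = fromℕ< (m%n<n (suc (toℕ i)) (suc m))

Cyclic : ∀ {n k} → Rel n k → Set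
Cyclic R = ∀ t → R t → R (λ i → t (rot i))

record Aut : Set where
  field
    fun     : ℚ → ℚ
    inv     : ℚ → ℚ
    inv-l   : ∀ x → inv (fun x) ≡ x
    inv-r   : ∀ x → fun (inv x) ≡ x
    mono    : ∀ x y → (x < y) ↔ (fun x < fun y)

IsPP : ℚ → (ℚ → ℚ → ℚ) → Set
IsPP q f = ∀ x y x' y' →
  (f x y ≤ f x' y') ↔ ((x ≤ q × x ≤ x') ⊎ (q < x × q < x' × y ≤ y'))

-- terms over pp, automorphisms and projections (= composition closure)
data Term (m : ℕ) : Set where
  var : Fin m → Term m
  aut : Aut → Term m → Term m
  ppT : Term m → Term m → Term m

eval : ∀ {m} → (ℚ → ℚ → ℚ) → Term m → (Fin m → ℚ) → ℚ
eval p (var i)   x = x i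
eval p (aut α t) x = Aut.fun α (eval p t x)
eval p (ppT s t) x = p (eval p s x) (eval p t x)

-- membership in ⟨pp⟩: the local closure of the term operations
In⟨pp⟩ : (ℚ → ℚ → ℚ) → (m : ℕ) → ((Fin m → ℚ) → ℚ) → Set
In⟨pp⟩ p m f = ∀ (F : List (Fin m → ℚ)) →
  ∃ λ (t : Term m) → All (λ x → eval p t x ≡ f x) F

applyOp : ∀ {m n k} → ((Fin m → ℚ) → ℚ) → (Fin m → Tuple n k) → Tuple n k
applyOp f ts i j = f (λ l → ts l i j)

PreservedBy⟨pp⟩ : ∀ {n k} → (ℚ → ℚ → ℚ) → Rel n k → Set
PreservedBy⟨pp⟩ {n} {k} p R =
  ∀ (m : ℕ) (f : (Fin m → ℚ) → ℚ) → In⟨pp⟩ p m f →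
  ∀ (ts : Fin m → Tuple n k) → (∀ l → R (ts l)) → R (applyOp f ts)

IsMinIdx : ∀ {k} → Vecℚ k → Fin k → Set
IsMinIdx a i = ∀ j → a i ≤ a j

-- i ∈ M(t)  iff  min(t_i) = min(t)
InM : ∀ {n k} → Tuple n k → Fin n → Set
InM t i = ∃ λ j → ∀ i' j' → t i j ≤ t i' j'

MinClean : ∀ {n k} → Tuple n k → Set
MinClean t = ∀ i i' → InM t i → InM t i' →
  ∀ j → IsMinIdx (t i) j ↔ IsMinIdx (t i') j

I₁≡ : ∀ {k} → Vecℚ k → Subset k → Set
I₁≡ a I = ∀ j → (j ∈ I) ↔ IsMinIdx a j

-- a ∼_{[k]∖I} b
SimOff : ∀ {k} → Subset k → Vecℚ k → Vecℚ k → Set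
SimOff I a b = ∀ j j' → j ∉ I → j' ∉ I → (a j ≤ a j') ↔ (b j ≤ b j')

iter : ∀ {A : Set} {n} → (A → A → A) → (Fin n → A) → A → A
iter {n = zero}  f a x = x
iter {n = suc n} f a x = f (a zero) (iter f (λ l → a (suc l)) x)

iterTuple : ∀ {n k} → (ℚ → ℚ → ℚ) → (Fin n → Tuple n k) → Tuple n k → Tuple n k
iterTuple f us u i j = iter f (λ l → us l i j) (u i j)

{-# OPTIONS --safe #-}
-- Take q = min u¹, let I = minx u¹ᵢ₀ for an entry u¹ᵢ₀ attaining q, and let uˡ⁺¹ be u¹ rotated
-- l times, which lies in R by cyclicity alone. Min-cleanliness splits the entries of u¹ into those
-- that are ≤ q exactly on I (and > q off I) and those that are > q everywhere. In pp_q(x, y) an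
-- argument x > q is transparent: the order is decided by y; an argument x ≤ q decides the order on
-- its own. Coordinate i of u' feeds every entry of u¹ into pp_q, u¹ᵢ₀ among them. Off I every
-- argument is transparent, so the order of uᵢ survives there; on I the first entry at level q
-- pushes the coordinates of I down to the minimum.

module Submission where

open import Defs
open import Data.Nat using (ℕ)
open import Data.Fin using (Fin; toℕ)
open import Data.Fin.Subset using (Subset)
open import Data.Rational using (ℚ; 0ℚ)
open import Data.Product using (Σ; ∃; _×_; _,_)
open import Relation.Binary.PropositionalEquality using (_≡_)

open import Data.Nat using (zero; suc; _+_; _∸_; _%_; NonZero)
open import Data.Nat.Properties
  using (+-assoc; +-comm; +-suc; +-identityʳ; m+[n∸m]≡n) renaming (<⇒≤ to <⇒≤ⁿ)
open import Data.Nat.DivMod using (%-distribˡ-+; m%n%n≡m%n; [m+n]%n≡m%n; m%n<n; m<n⇒m%n≡m)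
open import Data.Fin using (zero; suc; fromℕ<)
open import Data.Fin.Properties using (toℕ<n; toℕ-fromℕ<; toℕ-injective)
open import Data.Fin.Subset using (_∈_; _∉_; ⊥)
open import Data.Fin.Subset.Properties using (_∈?_)
open import Data.Vec using ([]; tabulate)
open import Data.Vec.Properties using (lookup∘tabulate; lookup⇒[]=; []=⇒lookup)
open import Data.List using (allFin)
open import Data.List.Relation.Unary.All as All using ()
open import Data.List.Membership.Propositional.Properties using (∈-allFin)
open import Data.Rational using (_≤_; _<_)
open import Data.Rational.Properties
  using (≤-refl; ≤-trans; <-≤-trans; <-irrefl; ≰⇒>; _≤?_; ≤-decTotalOrder)
open import Relation.Binary.Bundles using (DecTotalOrder)
open import Data.List.Extrema (DecTotalOrder.totalOrder ≤-decTotalOrder)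
  using (argmin; f[argmin]≤f[xs])
open import Data.Product using (proj₁; proj₂)
open import Data.Sum using (_⊎_; inj₁; inj₂)
open import Data.Empty using (⊥-elim)
open import Function using (_∘_; id)
open import Relation.Nullary using (¬_; Dec; yes; no; does)
open import Relation.Nullary.Decidable using (dec-true)
open import Relation.Binary.PropositionalEquality
  using (refl; sym; trans; cong; subst; module ≡-Reasoning)

<⇒≱ : ∀ {x y : ℚ} → x < y → ¬ (y ≤ x)
<⇒≱ x<y y≤x = <-irrefl refl (<-≤-trans x<y y≤x)

-- Opaque: otherwise unification unfolds the argmin fold over symbolic rationals, which is very slow.
opaque
  minIndex : ∀ {n} → (Fin (suc n) → ℚ) → Fin (suc n)
  minIndex f = argmin f zero (allFin _)

  minIndex-≤ : ∀ {n} (f : Fin (suc n) → ℚ) i → f (minIndex f) ≤ f i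
  minIndex-≤ f i = All.lookup (f[argmin]≤f[xs] {f = f} zero (allFin _)) (∈-allFin i)

module _ {k} {P : Fin k → Set} (P? : ∀ j → Dec (P j)) where

  toSubset : Subset k
  toSubset = tabulate (does ∘ P?)

  ∈-toSubset⁺ : ∀ {j} → P j → j ∈ toSubset
  ∈-toSubset⁺ {j} pj = lookup⇒[]= j _ (trans (lookup∘tabulate (does ∘ P?) j) (dec-true (P? j) pj))

  ∈-toSubset⁻ : ∀ {j} → j ∈ toSubset → P j
  ∈-toSubset⁻ {j} j∈ with P? j | trans (sym (lookup∘tabulate (does ∘ P?) j)) ([]=⇒lookup j∈)
  ... | yes pj | _ = pj
  ... | no _   | ()

[m+n%d]%d≡[m+n]%d : ∀ m n d .{{_ : NonZero d}} → (m + n % d) % d ≡ (m + n) % d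
[m+n%d]%d≡[m+n]%d m n d = begin
  (m + n % d) % d           ≡⟨ %-distribˡ-+ m (n % d) d ⟩
  (m % d + n % d % d) % d   ≡⟨ cong (λ x → (m % d + x) % d) (m%n%n≡m%n n d) ⟩
  (m % d + n % d) % d       ≡⟨ %-distribˡ-+ m n d ⟨
  (m + n) % d               ∎
  where open ≡-Reasoning

rotate : ∀ {n} → ℕ → Fin n → Fin n
rotate zero    i = i
rotate (suc d) i = rot (rotate d i)

cyclic-rotate : ∀ {n k} {R : Rel n k} → Cyclic R → ∀ d {t} → R t → R (t ∘ rotate d)
cyclic-rotate cyclic zero    t∈R = t∈R
cyclic-rotate cyclic (suc d) t∈R = cyclic-rotate cyclic d (cyclic _ t∈R)

toℕ-rotate : ∀ {m} d (i : Fin (suc m)) → toℕ (rotate d i) ≡ (toℕ i + d) % suc m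
toℕ-rotate {m} zero i = begin
  toℕ i                 ≡⟨ m<n⇒m%n≡m (toℕ<n i) ⟨
  toℕ i % suc m         ≡⟨ cong (_% suc m) (+-identityʳ (toℕ i)) ⟨
  (toℕ i + 0) % suc m   ∎
  where open ≡-Reasoning
toℕ-rotate {m} (suc d) i = begin
  toℕ (rot (rotate d i))             ≡⟨ toℕ-fromℕ< _ ⟩
  suc (toℕ (rotate d i)) % suc m     ≡⟨ cong (λ x → suc x % suc m) (toℕ-rotate d i) ⟩
  (1 + (toℕ i + d) % suc m) % suc m  ≡⟨ [m+n%d]%d≡[m+n]%d 1 (toℕ i + d) (suc m) ⟩
  suc (toℕ i + d) % suc m            ≡⟨ cong (_% suc m) (+-suc (toℕ i) d) ⟨
  (toℕ i + suc d) % suc m            ∎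
  where open ≡-Reasoning

rotate-transitive : ∀ {m} (i i' : Fin (suc m)) → ∃ λ (l : Fin (suc m)) → rotate (toℕ l) i ≡ i'
rotate-transitive {m} i i' = l , toℕ-injective (begin
  toℕ (rotate (toℕ l) i)    ≡⟨ toℕ-rotate (toℕ l) i ⟩
  (toℕ i + toℕ l) % n       ≡⟨ cong (λ x → (toℕ i + x) % n) (toℕ-fromℕ< _) ⟩
  (toℕ i + d % n) % n       ≡⟨ [m+n%d]%d≡[m+n]%d (toℕ i) d n ⟩
  (toℕ i + d) % n           ≡⟨ cong (_% n) (+-assoc (toℕ i) (n ∸ toℕ i) (toℕ i')) ⟨
  (toℕ i + (n ∸ toℕ i) + toℕ i') % n
                            ≡⟨ cong (λ x → (x + toℕ i') % n) (m+[n∸m]≡n (<⇒≤ⁿ (toℕ<n i))) ⟩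
  (n + toℕ i') % n          ≡⟨ cong (_% n) (+-comm n (toℕ i')) ⟩
  (toℕ i' + n) % n          ≡⟨ [m+n]%n≡m%n (toℕ i') n ⟩
  toℕ i' % n                ≡⟨ m<n⇒m%n≡m (toℕ<n i') ⟩
  toℕ i'                    ∎)
  where
  open ≡-Reasoning
  n : ℕ
  n = suc m
  d : ℕ
  d = (n ∸ toℕ i) + toℕ i'
  l : Fin n
  l = fromℕ< (m%n<n d n)

Separates : ∀ {k} → ℚ → Subset k → Vecℚ k → Set
Separates q I v = (∀ j → j ∈ I → v j ≤ q) × (∀ j → j ∉ I → q < v j)

Above : ∀ {k} → ℚ → Vecℚ k → Set
Above q v = ∀ j → q < v j

SeparatesOrAbove : ∀ {k} → ℚ → Subset k → Vecℚ k → Set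
SeparatesOrAbove q I v = Separates q I v ⊎ Above q v

module _ {k} {q : ℚ} {I : Subset k} {v : Vecℚ k} where

  above-off : ∀ {j} → SeparatesOrAbove q I v → j ∉ I → q < v j
  above-off (inj₁ (_ , off)) j∉I = off _ j∉I
  above-off (inj₂ above)     _   = above _

  above-on : ∀ {j} → SeparatesOrAbove q I v → j ∈ I → q < v j → Above q v
  above-on (inj₁ (on , _)) j∈I q<vⱼ = ⊥-elim (<⇒≱ q<vⱼ (on _ j∈I))
  above-on (inj₂ above)    _   _    = above

module PPIteration (q : ℚ) (f : ℚ → ℚ → ℚ) (isPP : IsPP q f) where

  pp-≤-low : ∀ {x x' y y'} → x ≤ q → x ≤ x' → f x y ≤ f x' y'
  pp-≤-low x≤q x≤x' = proj₂ (isPP _ _ _ _) (inj₁ (x≤q , x≤x'))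

  pp-≰-low : ∀ {x x' y y'} → q < x → x' ≤ q → ¬ (f x y ≤ f x' y')
  pp-≰-low {x} {x'} {y} {y'} q<x x'≤q le with proj₁ (isPP x y x' y') le
  ... | inj₁ (x≤q , _)      = <⇒≱ q<x x≤q
  ... | inj₂ (_ , q<x' , _) = <⇒≱ q<x' x'≤q

  pp-≤⇔-above : ∀ {x x' y y'} → q < x → q < x' → (f x y ≤ f x' y') ↔ (y ≤ y')
  pp-≤⇔-above {x} {x'} {y} {y'} q<x q<x' = to , from
    where
    to : f x y ≤ f x' y' → y ≤ y'
    to le with proj₁ (isPP x y x' y') le
    ... | inj₁ (x≤q , _)      = ⊥-elim (<⇒≱ q<x x≤q)
    ... | inj₂ (_ , _ , y≤y') = y≤y'
    from : y ≤ y' → f x y ≤ f x' y'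
    from y≤y' = proj₂ (isPP x y x' y') (inj₂ (q<x , q<x' , y≤y'))

  DipsBelow : ∀ {L} → (Fin L → ℚ) → Set
  DipsBelow x = ∃ λ l → x l ≤ q

  dipsBelow-tail : ∀ {L} {x : Fin (suc L) → ℚ} → ¬ (x zero ≤ q) → DipsBelow x → DipsBelow (x ∘ suc)
  dipsBelow-tail x₀≰q (zero  , x₀≤q) = ⊥-elim (x₀≰q x₀≤q)
  dipsBelow-tail x₀≰q (suc l , xₗ≤q) = l , xₗ≤q

  iter-≤⇔-above : ∀ {L} {x x' : Fin L → ℚ} {y y'} → (∀ l → q < x l) → (∀ l → q < x' l) →
                  (iter f x y ≤ iter f x' y') ↔ (y ≤ y')
  iter-≤⇔-above {zero}  q<x q<x' = id , id
  iter-≤⇔-above {suc L} {x} {x'} {y} {y'} q<x q<x' =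
    proj₁ tail ∘ proj₁ head , proj₂ head ∘ proj₂ tail
    where
    head : (f (x zero) (iter f (x ∘ suc) y) ≤ f (x' zero) (iter f (x' ∘ suc) y')) ↔
           (iter f (x ∘ suc) y ≤ iter f (x' ∘ suc) y')
    head = pp-≤⇔-above (q<x zero) (q<x' zero)
    tail : (iter f (x ∘ suc) y ≤ iter f (x' ∘ suc) y') ↔ (y ≤ y')
    tail = iter-≤⇔-above (q<x ∘ suc) (q<x' ∘ suc)

  iter-≤-low : ∀ {L} {x x' : Fin L → ℚ} {y y'} → DipsBelow x → (∀ l → q < x l → q < x' l) →
               (∀ l → q ≤ x' l) → iter f x y ≤ iter f x' y'
  iter-≤-low {zero}      (() , _)
  iter-≤-low {suc L} {x} dips above⇒above q≤x' with x zero ≤? q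
  ... | yes x₀≤q = pp-≤-low x₀≤q (≤-trans x₀≤q (q≤x' zero))
  ... | no  x₀≰q = proj₂ (pp-≤⇔-above q<x₀ (above⇒above zero q<x₀))
    (iter-≤-low (dipsBelow-tail x₀≰q dips) (above⇒above ∘ suc) (q≤x' ∘ suc))
    where
    q<x₀ : q < x zero
    q<x₀ = ≰⇒> x₀≰q

  iter-≰-low : ∀ {L} {x x' : Fin L → ℚ} {y y'} → (∀ l → q < x l) → DipsBelow x' →
               ¬ (iter f x y ≤ iter f x' y')
  iter-≰-low {zero}          _   (() , _)
  iter-≰-low {suc L} {x' = x'} q<x dips with x' zero ≤? q
  ... | yes x'₀≤q = pp-≰-low (q<x zero) x'₀≤q
  ... | no  x'₀≰q = iter-≰-low (q<x ∘ suc) (dipsBelow-tail x'₀≰q dips)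
                  ∘ proj₁ (pp-≤⇔-above (q<x zero) (≰⇒> x'₀≰q))

  iterVec : ∀ {k L} → (Fin L → Vecℚ k) → Vecℚ k → Vecℚ k
  iterVec a b j = iter f (λ l → a l j) (b j)

  module _ {k} {I : Subset k} where

    iterVec-SimOff : ∀ {L} {a : Fin L → Vecℚ k} b → (∀ l → SeparatesOrAbove q I (a l)) →
                     SimOff I (iterVec a b) b
    iterVec-SimOff b split j j' j∉I j'∉I =
      iter-≤⇔-above (λ l → above-off (split l) j∉I) (λ l → above-off (split l) j'∉I)

    iterVec-I₁ : ∀ {L} {a : Fin L → Vecℚ k} b → (∀ l → SeparatesOrAbove q I (a l)) →
                 (∀ l j → q ≤ a l j) → (∃ λ l → Separates q I (a l)) → ∃ (_∈ I) →
                 I₁≡ (iterVec a b) I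
    iterVec-I₁ {a = a} b split q≤a (l₀ , sep) (j₀ , j₀∈I) j = minimal , member
      where
      minimal : j ∈ I → IsMinIdx (iterVec a b) j
      minimal j∈I j' = iter-≤-low (l₀ , proj₁ sep j j∈I)
        (λ l q<aₗⱼ → above-on (split l) j∈I q<aₗⱼ j') (λ l → q≤a l j')
      member : IsMinIdx (iterVec a b) j → j ∈ I
      member isMin with j ∈? I
      ... | yes j∈I = j∈I
      ... | no  j∉I = ⊥-elim (iter-≰-low (λ l → above-off (split l) j∉I)
                                           (l₀ , proj₁ sep j₀ j₀∈I) (isMin j₀))

module MinimalEntry {m k} (u : Tuple (suc m) (suc k)) where

  i₀ : Fin (suc m)
  i₀ = minIndex (λ i → u i (minIndex (u i)))

  j₀ : Fin (suc k)
  j₀ = minIndex (u i₀)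

  minEntry : ℚ
  minEntry = u i₀ j₀

  minEntry-≤ : ∀ i j → minEntry ≤ u i j
  minEntry-≤ i j = ≤-trans (minIndex-≤ (λ i → u i (minIndex (u i))) i) (minIndex-≤ (u i) j)

  atMinimum? : ∀ j → Dec (u i₀ j ≤ minEntry)
  atMinimum? j = u i₀ j ≤? minEntry

  I : Subset (suc k)
  I = toSubset atMinimum?

  j₀∈I : j₀ ∈ I
  j₀∈I = ∈-toSubset⁺ atMinimum? ≤-refl

  i₀∈M : InM u i₀
  i₀∈M = j₀ , minEntry-≤

  ≤minEntry⇒IsMinIdx : ∀ {i j} → u i j ≤ minEntry → IsMinIdx (u i) j
  ≤minEntry⇒IsMinIdx {i} uᵢⱼ≤min j' = ≤-trans uᵢⱼ≤min (minEntry-≤ i j')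

  separates-i₀ : Separates minEntry I (u i₀)
  separates-i₀ = (λ _ → ∈-toSubset⁻ atMinimum?) , (λ _ j∉I → ≰⇒> (j∉I ∘ ∈-toSubset⁺ atMinimum?))

  separatesOrAbove : MinClean u → ∀ i → SeparatesOrAbove minEntry I (u i)
  separatesOrAbove minClean i with u i (minIndex (u i)) ≤? minEntry
  ... | no  min≰ = inj₂ λ j → <-≤-trans (≰⇒> min≰) (minIndex-≤ (u i) j)
  ... | yes min≤ = inj₁ (on , off)
    where
    sameMinx : ∀ j → IsMinIdx (u i) j ↔ IsMinIdx (u i₀) j
    sameMinx = minClean i i₀ (minIndex (u i) , λ i' j' → ≤-trans min≤ (minEntry-≤ i' j')) i₀∈M
    on : ∀ j → j ∈ I → u i j ≤ minEntry
    on j j∈I = ≤-trans (proj₂ (sameMinx j) (≤minEntry⇒IsMinIdx (∈-toSubset⁻ atMinimum? j∈I))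
                                  (minIndex (u i)))
                       min≤
    off : ∀ j → j ∉ I → minEntry < u i j
    off j j∉I = ≰⇒> λ uᵢⱼ≤min →
      j∉I (∈-toSubset⁺ atMinimum? (proj₁ (sameMinx j) (≤minEntry⇒IsMinIdx uᵢⱼ≤min) j₀))

lemma3p4 : (pp : ℚ → ℚ → ℚ → ℚ) → (∀ q → IsPP q (pp q)) →
    ∀ (n k : ℕ) (R : Rel n k) → Nonempty R → Cyclic R → PreservedBy⟨pp⟩ (pp 0ℚ) R →
    ∀ (u¹ : Tuple n k) → R u¹ → MinClean u¹ →
    Σ (Subset k) λ I → Σ ℚ λ q → Σ (Fin n → Tuple n k) λ us →
      (∀ l → R (us l)) × (∀ l → toℕ l ≡ 0 → us l ≡ u¹) ×
      (∀ u → R u →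
        (∀ i → I₁≡ (iterTuple (pp q) us u i) I) ×
        (∀ i → SimOff I (iterTuple (pp q) us u i) (u i)))
lemma3p4 _ _ zero _ _ _ _ _ _ _ _ =
  ⊥ , 0ℚ , (λ ()) , (λ ()) , (λ ()) , λ _ _ → (λ ()) , (λ ())
lemma3p4 _ _ (suc m) zero _ _ _ _ u¹ u¹∈R _ =
  [] , 0ℚ , (λ _ → u¹) , (λ _ → u¹∈R) , (λ _ _ → refl) , λ _ _ → (λ _ ()) , (λ _ ())
lemma3p4 pp isPP (suc m) (suc k) _ _ cyclic _ u¹ u¹∈R minClean =
  I , minEntry , us , (λ l → cyclic-rotate cyclic (toℕ l) u¹∈R) , (λ { zero _ → refl ; (suc _) () }) ,
  λ u _ → (λ i → iterVec-I₁ (u i) (split i) (λ _ → minEntry-≤ _) (separating i) (j₀ , j₀∈I))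
        , (λ i → iterVec-SimOff (u i) (split i))
  where
  open MinimalEntry u¹
  open PPIteration minEntry (pp minEntry) (isPP minEntry)
  us : Fin (suc m) → Tuple (suc m) (suc k)
  us l = u¹ ∘ rotate (toℕ l)
  split : ∀ i l → SeparatesOrAbove minEntry I (us l i)
  split i l = separatesOrAbove minClean (rotate (toℕ l) i)
  separating : ∀ i → ∃ λ l → Separates minEntry I (us l i)
  separating i with rotate-transitive i i₀
  ... | l , rotated-to-i₀ = l , subst (Separates minEntry I ∘ u¹) (sym rotated-to-i₀) separates-i₀
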